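{- Let $\mathcal{H}$ be a family of Hoffman graphs and $N$ a positive integer. Let $\mathcal{X}$ be the family, up to isomorphism, of Hoffman graphs $\mathfrak{h}=\bigoplus_{i\in I}\mathfrak{h}^i$ such that (a) $\mathfrak{h}^i\in\mathcal{H}$ for every $i\in I$, (b) $|V_s(\mathfrak{h})|=N$, and (c) the slim subgraph of $\mathfrak{h}$ is connected. Let $\mathcal{Y}$ be the family, up to isomorphism, of connected slim $\mathcal{H}$-line graphs of order $N$. Define $\Phi:\mathcal{X}\to\mathcal{Y}$ by letting $\Phi(\mathfrak{h})$ be the slim subgraph of $\mathfrak{h}$. If (I) $\Phi$ is surjective, (II) $\mathrm{Aut}^*(\mathfrak{n})=\{\mathrm{id}_{V(\mathfrak{n})}\}$ for every $\mathfrak{n}\in\mathcal{X}$, (III) $|\mathcal{X}|=|\mathcal{Y}|$, and (IV) $|\mathrm{Aut}(\mathfrak{n})|=|\mathrm{Aut}(\Phi(\mathfrak{n}))|$ for every $\mathfrak{n}\in\mathcal{X}$, then every graph in $\mathcal{Y}$ has a unique strict $\mathcal{H}$-cover up to equivalence.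
   Context: A Hoffman graph $\mathfrak{h}=(H,\mu)$ is a finite simple graph $H$ with labeling $\mu:V(H)\to\{f,s\}$ such that every fat vertex (label $f$) has a slim neighbour (label $s$), and fat vertices are pairwise non-adjacent. $V_s,V_f$ denote slim/fat vertex sets, $N^f_{\mathfrak{h}}(x)$ fat neighbours of $x$. A Hoffman subgraph is an induced subgraph with restricted labeling; isomorphisms/automorphisms are label-preserving; membership in families is up to isomorphism. The slim subgraph is the graph induced on $V_s$; ordinary graphs are Hoffman graphs without fat vertices, their order being the number of vertices. $\mathrm{Aut}^*(\mathfrak{h})=\{\psi\in\mathrm{Aut}(\mathfrak{h}):\psi|_{V_s(\mathfrak{h})}=\mathrm{id}\}$. Sum: $\mathfrak{h}=\bigoplus_i\mathfrak{h}^i$ (Hoffman subgraphs) means (i) $V(\mathfrak{h})=\bigcup V(\mathfrak{h}^i)$; (ii) $V_s(\mathfrak{h})$ is the disjoint union of the $V_s(\mathfrak{h}^i)$; (iii) $N^f_{\mathfrak{h}^i}(x)=N^f_{\mathfrak{h}}(x)$ for $x\in V_s(\mathfrak{h}^i)$; (iv) for slim $x\in\mathfrak{h}^i$, $y\in\mathfrak{h}^j$, $i\ne j$: $|N^f_{\mathfrak{h}}(x)\cap N^f_{\mathfrak{h}}(y)|\le1$ with equality iff $x,y$ adjacent. $\mathfrak{g}$ is an $\mathcal{H}$-line Hoffman graph if it is a Hoffman subgraph of some sum $\mathfrak{h}$ of members of $\mathcal{H}$ (an $\mathcal{H}$-cover; strict if $V_s(\mathfrak{h})=V_s(\mathfrak{g})$);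 a slim $\mathcal{H}$-line graph is such a $\mathfrak{g}$ without fat vertices. Strict covers $\mathfrak{h},\mathfrak{h}'$ of $\mathfrak{g}$ are equivalent if some isomorphism $\mathfrak{h}\to\mathfrak{h}'$ restricts to the identity on $V(\mathfrak{g})$. -}

module Defs where

open import Data.Nat using (ℕ; zero; suc; _+_; _≤_)
open import Data.Fin using (Fin; zero; suc)
open import Data.Bool using (Bool; true; false; if_then_else_; _∧_)
open import Data.Product using (Σ; ∃; ∃-syntax; _×_; _,_)
open import Relation.Binary.PropositionalEquality using (_≡_)
open import Relation.Nullary using (¬_)
open import Function.Definitions using (Injective; Bijective)

-- Slim vertices are Fin s, fat vertices are Fin f (the labeling μ is the
-- partition V = Fin s ⊎ Fin f).  Fat vertices are
-- pairwise non-adjacent by construction (no fat–fat adjacency field).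

record HoffmanGraph : Set where
  field
    s      : ℕ
    f      : ℕ
    adjSS  : Fin s → Fin s → Bool
    adjSF  : Fin s → Fin f → Bool
    irrefl : ∀ x → adjSS x x ≡ false
    sym    : ∀ x y → adjSS x y ≡ adjSS y x
    fatHasSlimNbr : ∀ z → ∃[ x ] adjSF x z ≡ true

open HoffmanGraph public

countFin : ∀ {n} → (Fin n → Bool) → ℕ
countFin {zero}  p = 0
countFin {suc n} p = (if p zero then 1 else 0) + countFin (λ i → p (suc i))

commonFat : (h : HoffmanGraph) → Fin (s h) → Fin (s h) → ℕ
commonFat h x y = countFin (λ z → adjSF h x z ∧ adjSF h y z)

record Iso (g h : HoffmanGraph) : Set where
  field
    σ     : Fin (s g) → Fin (s h)
    τ     : Fin (f g) → Fin (f h)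
    σ-bij : Bijective _≡_ _≡_ σ
    τ-bij : Bijective _≡_ _≡_ τ
    presSS : ∀ x y → adjSS h (σ x) (σ y) ≡ adjSS g x y
    presSF : ∀ x z → adjSF h (σ x) (τ z) ≡ adjSF g x z

open Iso public

_≅_ : HoffmanGraph → HoffmanGraph → Set
g ≅ h = Iso g h

Aut : HoffmanGraph → Set
Aut h = Iso h h

SameMap : ∀ {g h} → Iso g h → Iso g h → Set
SameMap ψ φ = (∀ x → σ ψ x ≡ σ φ x) × (∀ z → τ ψ z ≡ τ φ z)

AutCount : HoffmanGraph → ℕ → Set
AutCount h m =
  Σ (Fin m → Aut h) λ a →
    (∀ i j → SameMap (a i) (a j) → i ≡ j) ×
    (∀ ψ → ∃[ i ] SameMap ψ (a i))

AutStarTrivial : HoffmanGraph → Set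
AutStarTrivial h =
  ∀ (ψ : Aut h) → (∀ x → σ ψ x ≡ x) → (∀ z → τ ψ z ≡ z)

-- Hoffman subgraphs: an induced embedding g ↪ h identifies g with the
-- Hoffman subgraph of h induced on the images of σ and τ.

record Emb (g h : HoffmanGraph) : Set where
  field
    σ     : Fin (s g) → Fin (s h)
    τ     : Fin (f g) → Fin (f h)
    σ-inj : Injective _≡_ _≡_ σ
    τ-inj : Injective _≡_ _≡_ τ
    presSS : ∀ x y → adjSS h (σ x) (σ y) ≡ adjSS g x y
    presSF : ∀ x z → adjSF h (σ x) (τ z) ≡ adjSF g x z

module E = Emb

-- Families of Hoffman graphs are predicates; membership is up to iso.

Family : Set₁
Family = HoffmanGraph → Set

-- h = ⊕_{i ∈ Fin k} h^i with every h^i ∈ ℋ (up to isomorphism):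
-- h^i is the Hoffman subgraph of h given by the embedding e i of
-- a member g i of ℋ.
record SumDecomp (ℋ : Family) (h : HoffmanGraph) : Set where
  field
    k    : ℕ
    g    : Fin k → HoffmanGraph
    inℋ  : ∀ i → ℋ (g i)
    e    : ∀ i → Emb (g i) h
    -- (i) V(h) = ⋃ V(h^i)   (slim part covered by (ii))
    coverFat  : ∀ z → ∃[ i ] ∃[ w ] E.τ (e i) w ≡ z
    -- (ii) V_s(h) is the disjoint union of the V_s(h^i)
    coverSlim : ∀ x → ∃[ i ] ∃[ y ] E.σ (e i) y ≡ x
    disjSlim  : ∀ i j y y' → E.σ (e i) y ≡ E.σ (e j) y' → i ≡ j
    fatNbrs   : ∀ i y z → adjSF h (E.σ (e i) y) z ≡ true →
                ∃[ w ] E.τ (e i) w ≡ z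
    commonLe1 : ∀ i j y y' → ¬ i ≡ j →
                commonFat h (E.σ (e i) y) (E.σ (e j) y') ≤ 1
    commonEq1⇒adj : ∀ i j y y' → ¬ i ≡ j →
                commonFat h (E.σ (e i) y) (E.σ (e j) y') ≡ 1 →
                adjSS h (E.σ (e i) y) (E.σ (e j) y') ≡ true
    adj⇒commonEq1 : ∀ i j y y' → ¬ i ≡ j →
                adjSS h (E.σ (e i) y) (E.σ (e j) y') ≡ true →
                commonFat h (E.σ (e i) y) (E.σ (e j) y') ≡ 1

slimSubgraph : HoffmanGraph → HoffmanGraph
slimSubgraph h = record
  { s = s h ; f = 0 ; adjSS = adjSS h ; adjSF = λ _ ()
  ; irrefl = irrefl h ; sym = HoffmanGraph.sym h ; fatHasSlimNbr = λ () }

data Walk (h : HoffmanGraph) : Fin (s h) → Fin (s h) → Set where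
  here : ∀ {x} → Walk h x x
  step : ∀ {x y z} → adjSS h x y ≡ true → Walk h y z → Walk h x z

SlimConnected : HoffmanGraph → Set
SlimConnected h = ∀ x y → Walk h x y

IsOrdinary : HoffmanGraph → Set
IsOrdinary g = f g ≡ 0

IsLine : Family → HoffmanGraph → Set
IsLine ℋ g = Σ HoffmanGraph λ h → SumDecomp ℋ h × Emb g h

IsSlimLine : Family → HoffmanGraph → Set
IsSlimLine ℋ g = IsOrdinary g × IsLine ℋ g

record StrictCover (ℋ : Family) (g : HoffmanGraph) : Set where
  field
    cov    : HoffmanGraph
    decomp : SumDecomp ℋ cov
    emb    : Emb g cov
    strict : ∀ x → ∃[ y ] E.σ emb y ≡ x

open StrictCover public

EquivCovers : ∀ {ℋ g} → StrictCover ℋ g → StrictCover ℋ g → Set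
EquivCovers c c' =
  Σ (cov c ≅ cov c') λ ψ →
    (∀ y → σ ψ (E.σ (emb c) y) ≡ E.σ (emb c') y) ×
    (∀ z → τ ψ (E.τ (emb c) z) ≡ E.τ (emb c') z)

UniqueStrictCover : Family → HoffmanGraph → Set
UniqueStrictCover ℋ g =
  StrictCover ℋ g × (∀ c c' → EquivCovers {ℋ} {g} c c')

ClassCount : (HoffmanGraph → Set) → ℕ → Set
ClassCount P m =
  Σ (Fin m → HoffmanGraph) λ r →
    (∀ i → P (r i)) ×
    (∀ i j → r i ≅ r j → i ≡ j) ×
    (∀ h → P h → ∃[ i ] h ≅ r i)

𝒳 : Family → ℕ → HoffmanGraph → Set
𝒳 ℋ N h = SumDecomp ℋ h × (s h ≡ N) × SlimConnected h

𝒴 : Family → ℕ → HoffmanGraph → Set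
𝒴 ℋ N g = IsSlimLine ℋ g × SlimConnected g × (s g ≡ N)

Φ : HoffmanGraph → HoffmanGraph
Φ = slimSubgraph

module Submission where

-- Existence of a strict cover of g ∈ 𝒴 is (I) read backwards: if Φ h ≅ g with
-- h ∈ 𝒳, then h, with g placed on its slim vertices, is a strict cover.
-- For uniqueness, let c, c' be strict covers of g.  Both lie in 𝒳 and have
-- slim subgraph g, so the two identifications give χ : Φ(cov c) ≅ Φ(cov c')
-- fixing g.  Two independent facts finish the argument:
--   * Φ is injective on isomorphism classes: by (I) every 𝒴-class has a
--     𝒳-preimage class, distinct 𝒴-classes have distinct preimage classes,
--     and since both families have m classes (III) this injection of Fin m is
--     onto (pigeonhole).  Hence cov c ≅ cov c'.
--   * Automorphisms of Φ h extend to h for h ∈ 𝒳: restriction Aut h → Aut(Φ h)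
--     is injective because Aut* h is trivial (II), and |Aut h| = |Aut(Φ h)| (IV),
--     so restriction is onto.  Consequently any slim isomorphism χ between
--     isomorphic members of 𝒳 lifts to an isomorphism with the same slim part.
-- Lifting χ gives an isomorphism cov c ≅ cov c' that is the identity on g,
-- i.e. the two covers are equivalent.

open import Defs
open import Data.Nat using (ℕ; _≤_; suc)
open import Data.Product using (_×_; ∃-syntax; ∃; _,_; proj₁; proj₂)
open import Data.Fin using (Fin; punchOut)
open import Data.Fin.Properties
  using (any?; _≟_; ¬Fin0; punchOut-injective; injective⇒≤; cantor-schröder-bernstein)
open import Data.Nat.Properties using (1+n≰n)
open import Data.Empty using (⊥; ⊥-elim)
open import Relation.Nullary using (yes; no)
open import Relation.Binary.PropositionalEquality
  using (_≡_; refl; cong; cong₂; subst)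
  renaming (sym to ≡-sym; trans to ≡-trans)
open Relation.Binary.PropositionalEquality.≡-Reasoning
open import Function.Definitions using (Injective; Bijective; StrictlySurjective)
import Function.Construct.Symmetry as Symmetry
import Function.Construct.Composition as Composition

module _ {A B : Set} {φ : A → B} (bij : Bijective _≡_ _≡_ φ) where

  inverse : B → A
  inverse y = proj₁ (proj₂ bij y)

  inverseˡ : ∀ y → φ (inverse y) ≡ y
  inverseˡ y = proj₂ (proj₂ bij y) refl

  inverseʳ : ∀ x → inverse (φ x) ≡ x
  inverseʳ x = proj₁ bij (inverseˡ (φ x))

  inverse-bijective : Bijective _≡_ _≡_ inverse
  inverse-bijective = Symmetry.bijective bij refl ≡-sym ≡-trans (cong φ)

-- Pigeonhole: an injective self-map of a finite set is onto.  Otherwise it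
-- would miss some y and, after punching y out, inject Fin (suc n) into Fin n.
injective⇒strictlySurjective : ∀ {n} (h : Fin n → Fin n) →
  Injective _≡_ _≡_ h → StrictlySurjective _≡_ h
injective⇒strictlySurjective {suc n} h h-inj y with any? (λ x → h x ≟ y)
... | yes hit = hit
... | no miss = ⊥-elim (1+n≰n (injective⇒≤ squeeze-injective))
  where
  avoids : ∀ x → y ≡ h x → ⊥
  avoids x y≡hx = miss (x , ≡-sym y≡hx)

  squeeze : Fin (suc n) → Fin n
  squeeze x = punchOut (avoids x)

  squeeze-injective : Injective _≡_ _≡_ squeeze
  squeeze-injective {a} {b} e = h-inj (punchOut-injective (avoids a) (avoids b) e)

symIso : ∀ {g h} → g ≅ h → h ≅ g
symIso {g} {h} ψ = record
  { σ = inverse (σ-bij ψ) ; τ = inverse (τ-bij ψ)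
  ; σ-bij = inverse-bijective (σ-bij ψ) ; τ-bij = inverse-bijective (τ-bij ψ)
  ; presSS = λ x y → ≡-trans (≡-sym (presSS ψ _ _))
      (cong₂ (adjSS h) (inverseˡ (σ-bij ψ) x) (inverseˡ (σ-bij ψ) y))
  ; presSF = λ x z → ≡-trans (≡-sym (presSF ψ _ _))
      (cong₂ (adjSF h) (inverseˡ (σ-bij ψ) x) (inverseˡ (τ-bij ψ) z)) }

transIso : ∀ {g h k} → g ≅ h → h ≅ k → g ≅ k
transIso ψ φ = record
  { σ = λ x → σ φ (σ ψ x) ; τ = λ z → τ φ (τ ψ z)
  ; σ-bij = Composition.bijective _≡_ _≡_ _≡_ (σ-bij ψ) (σ-bij φ)
  ; τ-bij = Composition.bijective _≡_ _≡_ _≡_ (τ-bij ψ) (τ-bij φ)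
  ; presSS = λ x y → ≡-trans (presSS φ _ _) (presSS ψ x y)
  ; presSF = λ x z → ≡-trans (presSF φ _ _) (presSF ψ x z) }

Φ-cong : ∀ {g h} → g ≅ h → Φ g ≅ Φ h
Φ-cong ψ = record
  { σ = σ ψ ; τ = λ z → z
  ; σ-bij = σ-bij ψ ; τ-bij = (λ {z} → ⊥-elim (¬Fin0 z)) , λ ()
  ; presSS = presSS ψ ; presSF = λ _ () }

-- Choosing a P-preimage of each
-- Q-representative gives an injective, hence onto, map between the class
-- indices, so every P-class is the preimage class of a Q-class.
Φ-classInjective : ∀ {m} (P Q : HoffmanGraph → Set) →
  (∀ g → Q g → ∃[ h ] (P h × (Φ h ≅ g))) → ClassCount P m → ClassCount Q m →
  ∀ {h h'} → P h → P h' → Φ h ≅ Φ h' → h ≅ h'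
Φ-classInjective {m} P Q onto (repP , _ , _ , classifyP) (repQ , inQ , distinctQ , _)
                 {h} {h'} Ph Ph' Φh≅Φh' = sameClass
  where
  preimage : Fin m → HoffmanGraph
  preimage j = proj₁ (onto (repQ j) (inQ j))

  -- the P-class of the chosen preimage of the j-th Q-representative
  G : Fin m → Fin m
  G j = proj₁ (classifyP (preimage j) (proj₁ (proj₂ (onto (repQ j) (inQ j)))))

  over : ∀ j → Φ (repP (G j)) ≅ repQ j
  over j = transIso (symIso (Φ-cong (proj₂ (classifyP (preimage j) _))))
                    (proj₂ (proj₂ (onto (repQ j) (inQ j))))

  G-injective : Injective _≡_ _≡_ G
  G-injective {j} {j'} Gj≡Gj' = distinctQ j j'
    (transIso (symIso (over j))
      (subst (λ i → Φ (repP i) ≅ repQ j') (≡-sym Gj≡Gj') (over j')))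

  classOf : ∀ {k} → P k → ∃[ j ] (k ≅ repP (G j))
  classOf Pk with classifyP _ Pk
  ... | i , k≅repP-i with injective⇒strictlySurjective G G-injective i
  ...   | j , refl = j , k≅repP-i

  sameClass : h ≅ h'
  sameClass with classOf Ph | classOf Ph'
  ... | j , h≅ | j' , h'≅ with distinctQ j j'
         (transIso (symIso (over j)) (transIso (symIso (Φ-cong h≅))
           (transIso Φh≅Φh' (transIso (Φ-cong h'≅) (over j')))))
  ...   | refl = transIso h≅ (symIso h'≅)

-- When Aut* h is trivial, an automorphism of h is determined by its slim part:
-- φ⁻¹ ∘ ψ fixes every slim vertex, hence every fat vertex.
slimDetermines : ∀ {h} → AutStarTrivial h → (ψ φ : Aut h) →
  (∀ x → σ ψ x ≡ σ φ x) → ∀ z → τ ψ z ≡ τ φ z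
slimDetermines trivial ψ φ sameSlim z = begin
  τ ψ z                           ≡⟨ ≡-sym (inverseˡ (τ-bij φ) (τ ψ z)) ⟩
  τ φ (inverse (τ-bij φ) (τ ψ z)) ≡⟨ cong (τ φ) (fixesFat z) ⟩
  τ φ z                           ∎
  where
  fixesSlim : ∀ x → inverse (σ-bij φ) (σ ψ x) ≡ x
  fixesSlim x = ≡-trans (cong (inverse (σ-bij φ)) (sameSlim x)) (inverseʳ (σ-bij φ) x)

  fixesFat : ∀ z → inverse (τ-bij φ) (τ ψ z) ≡ z
  fixesFat = trivial (transIso ψ (symIso φ)) fixesSlim

ExtendsAutomorphisms : HoffmanGraph → Set
ExtendsAutomorphisms h = (γ : Aut (Φ h)) → ∃ λ (θ : Aut h) → ∀ x → σ θ x ≡ σ γ x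

-- Restriction of automorphisms, read on the enumerations of Aut h and Aut (Φ h),
-- is an injective self-map of Fin m (slimDetermines), hence onto.
automorphismsExtend : ∀ {h m} → AutStarTrivial h →
  AutCount h m → AutCount (Φ h) m → ExtendsAutomorphisms h
automorphismsExtend {h} {m} trivial (a , a-distinct , _) (b , _ , b-complete) γ =
  a i , λ x → begin
    σ (a i) x            ≡⟨ restrict-σ i x ⟩
    σ (b (restrict i)) x ≡⟨ cong (λ k → σ (b k) x) restricts-to-γ ⟩
    σ (b k) x            ≡⟨ ≡-sym (proj₁ (proj₂ (b-complete γ)) x) ⟩
    σ γ x                ∎
  where
  restrict : Fin m → Fin m
  restrict i = proj₁ (b-complete (Φ-cong (a i)))

  restrict-σ : ∀ i x → σ (a i) x ≡ σ (b (restrict i)) x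
  restrict-σ i = proj₁ (proj₂ (b-complete (Φ-cong (a i))))

  restrict-injective : Injective _≡_ _≡_ restrict
  restrict-injective {i} {j} e =
    a-distinct i j (sameSlim , slimDetermines trivial (a i) (a j) sameSlim)
    where
    sameSlim : ∀ x → σ (a i) x ≡ σ (a j) x
    sameSlim x = ≡-trans (restrict-σ i x)
                   (≡-trans (cong (λ k → σ (b k) x) e) (≡-sym (restrict-σ j x)))

  k : Fin m
  k = proj₁ (b-complete γ)

  i : Fin m
  i = proj₁ (injective⇒strictlySurjective restrict restrict-injective k)

  restricts-to-γ : restrict i ≡ k
  restricts-to-γ = proj₂ (injective⇒strictlySurjective restrict restrict-injective k)

-- If automorphisms of Φ h extend to h, every slim isomorphism χ : Φ h ≅ Φ h'
-- between isomorphic h ≅ h' lifts: extend ψ⁻¹ ∘ χ to θ ∈ Aut h; then ψ ∘ θ lies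
-- over χ.
liftSlimIso : ∀ {h h'} → ExtendsAutomorphisms h → h ≅ h' →
  (χ : Φ h ≅ Φ h') → ∃ λ (φ : h ≅ h') → ∀ x → σ φ x ≡ σ χ x
liftSlimIso {h} extends ψ χ = transIso θ ψ , λ x → begin
  σ ψ (σ θ x)                        ≡⟨ cong (σ ψ) (θ-over x) ⟩
  σ ψ (inverse (σ-bij ψ) (σ χ x))    ≡⟨ inverseˡ (σ-bij ψ) (σ χ x) ⟩
  σ χ x                              ∎
  where
  θ : Aut h
  θ = proj₁ (extends (transIso χ (symIso (Φ-cong ψ))))

  θ-over : ∀ x → σ θ x ≡ inverse (σ-bij ψ) (σ χ x)
  θ-over = proj₂ (extends (transIso χ (symIso (Φ-cong ψ))))

PreservesSlimAdjacency : (g h : HoffmanGraph) → (Fin (s g) → Fin (s h)) → Set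
PreservesSlimAdjacency g h α = ∀ x y → adjSS h (α x) (α y) ≡ adjSS g x y

mapWalk : ∀ {g h} (α : Fin (s g) → Fin (s h)) → PreservesSlimAdjacency g h α →
  ∀ {x y} → Walk g x y → Walk h (α x) (α y)
mapWalk α pres here = here
mapWalk α pres (step xy walk) = step (≡-trans (pres _ _) xy) (mapWalk α pres walk)

connected-onto : ∀ {g h} (α : Fin (s g) → Fin (s h)) → PreservesSlimAdjacency g h α →
  StrictlySurjective _≡_ α → SlimConnected g → SlimConnected h
connected-onto α pres onto connected x y with onto x | onto y
... | x₀ , refl | y₀ , refl = mapWalk α pres (connected x₀ y₀)

iso⇒sameOrder : ∀ {g h} → g ≅ h → s g ≡ s h
iso⇒sameOrder ψ = cantor-schröder-bernstein (proj₁ (σ-bij ψ)) (proj₁ (σ-bij (symIso ψ)))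

-- Strict covers of an ordinary graph g.  The embedding identifies g with the slim
-- subgraph of the cover.
module StrictCovers {ℋ : Family} {g : HoffmanGraph} (ordinary : IsOrdinary g) where

  -- every statement about a fat vertex of g holds vacuously
  noFatVertex : ∀ {A : Set} → Fin (f g) → A
  noFatVertex z = ⊥-elim (¬Fin0 (subst Fin ordinary z))

  slimOfCover : (c : StrictCover ℋ g) → g ≅ Φ (cov c)
  slimOfCover c = record
    { σ = E.σ (emb c) ; τ = noFatVertex
    ; σ-bij = E.σ-inj (emb c) ,
              λ x → proj₁ (strict c x) , λ { refl → proj₂ (strict c x) }
    ; τ-bij = (λ {z} → noFatVertex z) , λ ()
    ; presSS = E.presSS (emb c) ; presSF = λ _ z → noFatVertex z }

  coverOf : ∀ {h} → SumDecomp ℋ h → Φ h ≅ g → StrictCover ℋ g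
  coverOf {h} decomposition Φh≅g = record
    { cov = h ; decomp = decomposition
    ; emb = record
      { σ = σ ψ ; τ = noFatVertex
      ; σ-inj = proj₁ (σ-bij ψ) ; τ-inj = λ {z} → noFatVertex z
      ; presSS = presSS ψ ; presSF = λ _ z → noFatVertex z }
    ; strict = λ x → inverse (σ-bij ψ) x , inverseˡ (σ-bij ψ) x }
    where
    ψ : g ≅ Φ h
    ψ = symIso Φh≅g

  slimIsoBetween : (c c' : StrictCover ℋ g) → Φ (cov c) ≅ Φ (cov c')
  slimIsoBetween c c' = transIso (symIso (slimOfCover c)) (slimOfCover c')

  slimIsoBetween-overG : ∀ c c' y →
    σ (slimIsoBetween c c') (E.σ (emb c) y) ≡ E.σ (emb c') y
  slimIsoBetween-overG c c' y = cong (E.σ (emb c')) (inverseʳ (σ-bij (slimOfCover c)) y)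

  cover∈𝒳 : ∀ {N} → 𝒴 ℋ N g → (c : StrictCover ℋ g) → 𝒳 ℋ N (cov c)
  cover∈𝒳 (_ , connected , order) c =
    decomp c ,
    ≡-trans (≡-sym (iso⇒sameOrder (slimOfCover c))) order ,
    connected-onto (E.σ (emb c)) (E.presSS (emb c)) (strict c) connected

  -- An isomorphism of covers that matches the two copies of g is an equivalence
  -- (there is no fat vertex of g to match).
  equivalentCovers : (c c' : StrictCover ℋ g) (φ : cov c ≅ cov c') →
    (∀ y → σ φ (E.σ (emb c) y) ≡ E.σ (emb c') y) → EquivCovers {ℋ} {g} c c'
  equivalentCovers c c' φ overG = φ , overG , λ z → noFatVertex z

proposition5p4 : (ℋ : Family) (N : ℕ) → 1 ≤ N →
    (∀ g → 𝒴 ℋ N g → ∃[ h ] (𝒳 ℋ N h × (Φ h ≅ g))) →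
    (∀ h → 𝒳 ℋ N h → AutStarTrivial h) →
    (∃[ m ] (ClassCount (𝒳 ℋ N) m × ClassCount (𝒴 ℋ N) m)) →
    (∀ h → 𝒳 ℋ N h → ∃[ m ] (AutCount h m × AutCount (Φ h) m)) →
    ∀ g → 𝒴 ℋ N g → UniqueStrictCover ℋ g
proposition5p4 ℋ N _ onto trivial (_ , classes𝒳 , classes𝒴) autCounts g g∈𝒴 =
  coverOf (proj₁ h∈𝒳) Φh≅g , uniqueness
  where
  open StrictCovers {ℋ} (proj₁ (proj₁ g∈𝒴))

  h∈𝒳 : 𝒳 ℋ N (proj₁ (onto g g∈𝒴))
  h∈𝒳 = proj₁ (proj₂ (onto g g∈𝒴))

  Φh≅g : Φ (proj₁ (onto g g∈𝒴)) ≅ g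
  Φh≅g = proj₂ (proj₂ (onto g g∈𝒴))

  extends : ∀ h → 𝒳 ℋ N h → ExtendsAutomorphisms h
  extends h h∈𝒳 = automorphismsExtend (trivial h h∈𝒳)
    (proj₁ (proj₂ (autCounts h h∈𝒳))) (proj₂ (proj₂ (autCounts h h∈𝒳)))

  uniqueness : ∀ c c' → EquivCovers c c'
  uniqueness c c' = equivalentCovers c c' (proj₁ lift)
    (λ y → ≡-trans (proj₂ lift (E.σ (emb c) y)) (slimIsoBetween-overG c c' y))
    where
    covers≅ : cov c ≅ cov c'
    covers≅ = Φ-classInjective (𝒳 ℋ N) (𝒴 ℋ N) onto classes𝒳 classes𝒴
                (cover∈𝒳 g∈𝒴 c) (cover∈𝒳 g∈𝒴 c') (slimIsoBetween c c')

    lift : ∃ λ (φ : cov c ≅ cov c') → ∀ x → σ φ x ≡ σ (slimIsoBetween c c') x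
    lift = liftSlimIso (extends (cov c) (cover∈𝒳 g∈𝒴 c)) covers≅ (slimIsoBetween c c')
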